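{- Let $T$ be a tree of order $n$, let $p\geq 2$ be an integer and $q\in\mathbb{N}\cup\{\infty\}$. Then $\sigma_{(p,q)}(T)\geq \left\lceil \frac{p-1}{p}n+\frac{1}{p}\right\rceil$.
   Context: Vertices are colored white or blue. Spreading color change rule with parameters $p\in\mathbb{N}$, $q\in\mathbb{N}\cup\{\infty\}$: if a white vertex $w$ has at least $p$ blue neighbors, and one of the blue neighbors of $w$ has at most $q$ white neighbors, then $w$ is recolored blue ($q=\infty$ imposes no restriction). A set $S$ is a $(p,q)$-spreading set if, when exactly the vertices of $S$ are initially blue, repeated application of this rule eventually makes all vertices blue; $\sigma_{(p,q)}(G)$ is the minimum size of a $(p,q)$-spreading set of $G$. -}

module Defs where

open import Data.Nat using (ℕ; zero; suc; _+_; _*_; _∸_; _≤_; _<_; NonZero)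
open import Data.Nat.DivMod using (_/_)
open import Data.Bool using (Bool; true; false; if_then_else_; _∧_)
open import Data.Fin using (Fin; _≟_)
open import Data.Maybe using (Maybe; just; nothing)
open import Data.List using (List; []; _∷_)
open import Data.List.Relation.Unary.Unique.Propositional using (Unique)
open import Data.Product using (Σ; ∃; ∃-syntax; _×_; _,_)
open import Data.Unit using (⊤)
open import Relation.Binary.PropositionalEquality using (_≡_)
open import Relation.Nullary using (¬_; does)
open import Relation.Binary.Construct.Closure.ReflexiveTransitive using (Star)

record Graph (n : ℕ) : Set where
  field
    adj   : Fin n → Fin n → Bool
    sym   : ∀ u v → adj u v ≡ adj v u
    irrefl : ∀ v → adj v v ≡ false
open Graph public

Adj : ∀ {n} → Graph n → Fin n → Fin n → Set
Adj G u v = adj G u v ≡ true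

countTrue : ∀ {n} → (Fin n → Bool) → ℕ
countTrue {zero}  f = 0
countTrue {suc n} f = (if f Fin.zero then 1 else 0) + countTrue {n} (λ i → f (Fin.suc i))

data Walk {n : ℕ} (G : Graph n) : Fin n → Fin n → Set where
  here  : ∀ {v} → Walk G v v
  there : ∀ {u w v} → Adj G u w → Walk G w v → Walk G u v

Connected : ∀ {n} → Graph n → Set
Connected {n} G = ∀ (u v : Fin n) → Walk G u v

data PathList {n : ℕ} (G : Graph n) : Fin n → List (Fin n) → Fin n → Set where
  single : ∀ {v} → PathList G v (v ∷ []) v
  cons   : ∀ {u w v xs} → Adj G u w → PathList G w xs v → PathList G u (u ∷ xs) v

-- A cycle: distinct vertices v₀,…,v_k with k ≥ 2, v_i ~ v_{i+1}, and v_k ~ v₀.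
HasCycle : ∀ {n} → Graph n → Set
HasCycle {n} G =
  Σ (Fin n) λ u → Σ (Fin n) λ v → Σ (Fin n) λ a → Σ (Fin n) λ b → Σ (List (Fin n)) λ xs →
    PathList G u (u ∷ a ∷ b ∷ xs) v × Unique (u ∷ a ∷ b ∷ xs) × Adj G v u

Acyclic : ∀ {n} → Graph n → Set
Acyclic G = ¬ HasCycle G

IsTree : ∀ {n} → Graph n → Set
IsTree G = Connected G × Acyclic G

-- Colourings: true = blue, false = white.
Colouring : ℕ → Set
Colouring n = Fin n → Bool

blueNbrs : ∀ {n} → Graph n → Colouring n → Fin n → ℕ
blueNbrs G c w = countTrue (λ v → adj G w v ∧ c v)

whiteNbrs : ∀ {n} → Graph n → Colouring n → Fin n → ℕ
whiteNbrs G c u = countTrue (λ v → adj G u v ∧ (if c v then false else true))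

-- q ∈ ℕ ∪ {∞}: nothing encodes ∞.
AtMost : ℕ → Maybe ℕ → Set
AtMost k (just q) = k ≤ q
AtMost k nothing  = ⊤

RuleApplies : ∀ {n} → Graph n → ℕ → Maybe ℕ → Colouring n → Fin n → Set
RuleApplies {n} G p q c w =
  c w ≡ false × p ≤ blueNbrs G c w ×
  ∃[ u ] (Adj G w u × c u ≡ true × AtMost (whiteNbrs G c u) q)

Step : ∀ {n} → Graph n → ℕ → Maybe ℕ → Colouring n → Colouring n → Set
Step {n} G p q c c' =
  ∃[ w ] (RuleApplies G p q c w × (∀ v → c' v ≡ (if does (v ≟ w) then true else c v)))

IsSpreadingSet : ∀ {n} → Graph n → ℕ → Maybe ℕ → (Fin n → Bool) → Set
IsSpreadingSet {n} G p q S =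
  ∃[ c ] (Star (Step G p q) S c × (∀ v → c v ≡ true))

⌈_/_⌉ : (a b : ℕ) → .{{NonZero b}} → ℕ
⌈ a / b ⌉ = (a + (b ∸ 1)) / b

-- Let Φ(c) be the sum, over blue vertices, of their numbers of blue neighbours, i.e. twice the
-- number of blue–blue edges. Turning a white vertex w blue raises Φ by twice the number of blue
-- neighbours of w, so each spreading step adds one blue vertex and raises Φ by at least 2p; a
-- spreading set S thus forces Φ(all blue) ≥ 2p(n − |S|). In a forest Φ(all blue) ≤ 2(n − 1): some
-- blue vertex has at most one blue neighbour (otherwise a non-backtracking walk through blue
-- vertices closes a cycle), and whitening it lowers Φ by at most 2. Hence p(n − |S|) ≤ n − 1,
-- that is p|S| ≥ (p − 1)n + 1.
module Submission where

open import Defs hiding (sym)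
open import Data.Nat using (ℕ; zero; suc; pred; _+_; _*_; _∸_; _≤_; _<_; _≤?_; z≤n; s≤s; s≤s⁻¹; NonZero)
open import Data.Nat.Properties hiding (_≟_)
open import Data.Nat.DivMod using (_/_; m<n*o⇒m/o<n)
open import Data.Nat.Induction using (<-rec)
open import Data.Nat.Tactic.RingSolver using (solve-∀)
open import Data.Bool using (Bool; true; false; if_then_else_; _∧_) renaming (_≟_ to _≟ᵇ_)
open import Data.Bool.Properties using (∧-conicalˡ; ∧-conicalʳ; ∧-identityʳ; ∧-zeroʳ)
open import Data.Fin using (Fin; punchIn; toℕ; _≟_)
open import Data.Fin.Properties using (punchInᵢ≢i; pigeonhole; any?)
open import Data.Vec.Functional using (removeAt)
open import Data.List using (applyUpTo)
open import Data.List.Relation.Unary.Unique.Propositional.Properties using (applyUpTo⁺₁)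
open import Data.Maybe using (Maybe)
open import Data.Product using (∃; _×_; _,_; proj₁; proj₂)
open import Function using (_∘_)
open import Relation.Binary.PropositionalEquality
open import Relation.Binary.Construct.Closure.ReflexiveTransitive using (Star; ε; _◅_)
open import Relation.Nullary using (yes; no; does; contradiction)
open import Relation.Nullary.Decidable using (dec-true; dec-false; _×-dec_)
open import Algebra.Properties.CommutativeMonoid.Sum +-0-commutativeMonoid
  using (sum; sum-remove; sum-cong-≗; ∑-distrib-+; sum-replicate-zero)

indicator : Bool → ℕ
indicator b = if b then 1 else 0

indicator≤1 : ∀ b → indicator b ≤ 1
indicator≤1 true  = ≤-refl
indicator≤1 false = z≤n

countTrue≡sum : ∀ {n} (f : Fin n → Bool) → countTrue f ≡ sum (indicator ∘ f)
countTrue≡sum {zero}  f = refl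
countTrue≡sum {suc n} f = cong (indicator (f Fin.zero) +_) (countTrue≡sum (f ∘ Fin.suc))

countTrue-cong : ∀ {n} {f g : Fin n → Bool} → (∀ i → f i ≡ g i) → countTrue f ≡ countTrue g
countTrue-cong {zero}  f≗g = refl
countTrue-cong {suc n} f≗g = cong₂ _+_ (cong indicator (f≗g Fin.zero)) (countTrue-cong (f≗g ∘ Fin.suc))

countTrue-removeAt : ∀ {n} (f : Fin (suc n) → Bool) i → countTrue f ≡ indicator (f i) + countTrue (removeAt f i)
countTrue-removeAt f i = begin
  countTrue f                                      ≡⟨ countTrue≡sum f ⟩
  sum (indicator ∘ f)                              ≡⟨ sum-remove (indicator ∘ f) ⟩
  indicator (f i) + sum (indicator ∘ removeAt f i) ≡⟨ cong (indicator (f i) +_) (countTrue≡sum (removeAt f i)) ⟨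
  indicator (f i) + countTrue (removeAt f i)       ∎
  where open ≡-Reasoning

countTrue-removeAt-false : ∀ {n} (f : Fin (suc n) → Bool) i → f i ≡ false → countTrue f ≡ countTrue (removeAt f i)
countTrue-removeAt-false f i fᵢ = trans (countTrue-removeAt f i) (cong (λ b → indicator b + countTrue (removeAt f i)) fᵢ)

countTrue-mono : ∀ {n} {f g : Fin n → Bool} → (∀ i → f i ≡ true → g i ≡ true) → countTrue f ≤ countTrue g
countTrue-mono {zero}  f⇒g = z≤n
countTrue-mono {suc n} f⇒g = +-mono-≤ (indicator-mono (f⇒g Fin.zero)) (countTrue-mono (f⇒g ∘ Fin.suc))
  where
  indicator-mono : ∀ {a b} → (a ≡ true → b ≡ true) → indicator a ≤ indicator b
  indicator-mono {false}         _   = z≤n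
  indicator-mono {true}  {true}  _   = ≤-refl
  indicator-mono {true}  {false} a⇒b = contradiction (a⇒b refl) λ ()

countTrue-exists : ∀ {n} (f : Fin n → Bool) → 1 ≤ countTrue f → ∃ λ i → f i ≡ true
countTrue-exists {suc n} f one with f Fin.zero in f₀
... | true  = Fin.zero , f₀
... | false = let i , fᵢ = countTrue-exists (f ∘ Fin.suc) one in Fin.suc i , fᵢ

countTrue≡0 : ∀ {n} {f : Fin n → Bool} → countTrue f ≡ 0 → ∀ i → f i ≡ false
countTrue≡0 {suc n} {f} none i with f i | countTrue-removeAt f i
... | false | _     = refl
... | true  | split = contradiction (trans (sym split) none) λ ()

countTrue-all : ∀ {n} {f : Fin n → Bool} → (∀ i → f i ≡ true) → countTrue f ≡ n
countTrue-all {zero}      all = refl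
countTrue-all {suc n} {f} all rewrite all Fin.zero = cong suc (countTrue-all (all ∘ Fin.suc))

recolour : ∀ {n} → Colouring n → Fin n → Bool → Colouring n
recolour c w b v = if does (v ≟ w) then b else c v

recolour-at : ∀ {n} (c : Colouring n) w b → recolour c w b w ≡ b
recolour-at c w b rewrite dec-true (w ≟ w) refl = refl

recolour-off : ∀ {n} (c : Colouring (suc n)) w b u → recolour c w b (punchIn w u) ≡ c (punchIn w u)
recolour-off c w b u rewrite dec-false (punchIn w u ≟ w) (punchInᵢ≢i w u) = refl

blueNbrs≤countTrue : ∀ {n} (G : Graph n) c v → blueNbrs G c v ≤ countTrue c
blueNbrs≤countTrue G c v = countTrue-mono λ u → ∧-conicalʳ (adj G v u) (c u)

blueDegree : ∀ {n} → Graph n → Colouring n → Fin n → ℕ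
blueDegree G c v = if c v then blueNbrs G c v else 0

blueDegreeSum : ∀ {n} → Graph n → Colouring n → ℕ
blueDegreeSum G c = sum (blueDegree G c)

blueDegreeSum-white : ∀ {n} (G : Graph n) c → (∀ v → c v ≡ false) → blueDegreeSum G c ≡ 0
blueDegreeSum-white {n} G c white =
  trans (sum-cong-≗ λ v → cong (λ b → if b then blueNbrs G c v else 0) (white v)) (sum-replicate-zero n)

module Recolouring {n} (G : Graph (suc n)) {c c' : Colouring (suc n)} {w : Fin (suc n)}
  (white : c w ≡ false) (blue : c' w ≡ true) (agree : ∀ u → c' (punchIn w u) ≡ c (punchIn w u)) where

  countTrue-recolour : countTrue c' ≡ suc (countTrue c)
  countTrue-recolour = begin
    countTrue c'                                 ≡⟨ countTrue-removeAt c' w ⟩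
    indicator (c' w) + countTrue (removeAt c' w) ≡⟨ cong₂ (λ b k → indicator b + k) blue (countTrue-cong agree) ⟩
    suc (countTrue (removeAt c w))               ≡⟨ cong suc (countTrue-removeAt-false c w white) ⟨
    suc (countTrue c)                            ∎
    where open ≡-Reasoning

  blueNbrs-recolour : ∀ v → blueNbrs G c' v ≡ indicator (adj G v w) + blueNbrs G c v
  blueNbrs-recolour v = begin
    blueNbrs G c' v
      ≡⟨ countTrue-removeAt (λ u → adj G v u ∧ c' u) w ⟩
    indicator (adj G v w ∧ c' w) + countTrue (removeAt (λ u → adj G v u ∧ c' u) w)
      ≡⟨ cong₂ _+_ (cong indicator (trans (cong (adj G v w ∧_) blue) (∧-identityʳ _)))
                   (countTrue-cong λ u → cong (adj G v (punchIn w u) ∧_) (agree u)) ⟩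
    indicator (adj G v w) + countTrue (removeAt (λ u → adj G v u ∧ c u) w)
      ≡⟨ cong (indicator (adj G v w) +_) (countTrue-removeAt-false (λ u → adj G v u ∧ c u) w
                                            (trans (cong (adj G v w ∧_) white) (∧-zeroʳ _))) ⟨
    indicator (adj G v w) + blueNbrs G c v
      ∎
    where open ≡-Reasoning

  blueNbrs-recolour-self : blueNbrs G c' w ≡ blueNbrs G c w
  blueNbrs-recolour-self = trans (blueNbrs-recolour w) (cong (λ b → indicator b + blueNbrs G c w) (irrefl G w))

  private
    X = blueNbrs G c w

    blueDegree-off : ∀ u → blueDegree G c' (punchIn w u)
                         ≡ blueDegree G c (punchIn w u) + indicator (adj G w (punchIn w u) ∧ c (punchIn w u))
    blueDegree-off u with c' (punchIn w u) | c (punchIn w u) | agree u | blueNbrs-recolour (punchIn w u)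
    ... | true  | true  | refl | nbrs =
      trans nbrs (trans (+-comm (indicator (adj G v w)) (blueNbrs G c v))
                        (cong (λ b → blueNbrs G c v + indicator b) (trans (Graph.sym G v w) (sym (∧-identityʳ _)))))
      where v = punchIn w u
    ... | false | false | refl | _    = sym (cong indicator (∧-zeroʳ _))

  blueDegreeSum-recolour : blueDegreeSum G c' ≡ blueDegreeSum G c + 2 * blueNbrs G c w
  blueDegreeSum-recolour = begin
    blueDegreeSum G c'
      ≡⟨ sum-remove {i = w} (blueDegree G c') ⟩
    blueDegree G c' w + sum (removeAt (blueDegree G c') w)
      ≡⟨ cong₂ _+_ blueDegree-at (sum-cong-≗ blueDegree-off) ⟩
    X + sum (λ u → blueDegree G c (punchIn w u) + indicator (adj G w (punchIn w u) ∧ c (punchIn w u)))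
      ≡⟨ cong (X +_) (∑-distrib-+ (removeAt (blueDegree G c) w) (indicator ∘ removeAt blueNbr w)) ⟩
    X + (sum (removeAt (blueDegree G c) w) + sum (indicator ∘ removeAt blueNbr w))
      ≡⟨ cong₂ (λ a b → X + (a + b)) blueDegreeSum-off X-off ⟨
    X + (blueDegreeSum G c + X)
      ≡⟨ rearrange X (blueDegreeSum G c) ⟩
    blueDegreeSum G c + 2 * X
      ∎
    where
    open ≡-Reasoning
    blueNbr : Fin (suc n) → Bool
    blueNbr v = adj G w v ∧ c v
    blueDegree-at : blueDegree G c' w ≡ X
    blueDegree-at = trans (cong (λ b → if b then blueNbrs G c' w else 0) blue) blueNbrs-recolour-self
    blueDegreeSum-off : blueDegreeSum G c ≡ sum (removeAt (blueDegree G c) w)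
    blueDegreeSum-off = trans (sum-remove {i = w} (blueDegree G c))
                              (cong (λ b → (if b then X else 0) + sum (removeAt (blueDegree G c) w)) white)
    X-off : X ≡ sum (indicator ∘ removeAt blueNbr w)
    X-off = trans (countTrue-removeAt-false blueNbr w (cong (_∧ c w) (irrefl G w))) (countTrue≡sum (removeAt blueNbr w))
    rearrange : ∀ x d → x + (d + x) ≡ d + 2 * x
    rearrange = solve-∀

module _ {a ℓ} {A : Set a} {R : A → A → Set ℓ} (N Φ : A → ℕ) (k : ℕ)
         (step : ∀ {x y} → R x y → N y ≡ suc (N x) × Φ x + k ≤ Φ y) where

  star-potential : ∀ {x y} → Star R x y → Φ x + k * N y ≤ Φ y + k * N x
  star-potential ε = ≤-refl
  star-potential {x} {y} (x→z ◅ z→*y) with step x→z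
  ... | Nz≡ , Φx+k≤Φz = +-cancelʳ-≤ k _ _ (begin
    Φ x + k * N y + k     ≡⟨ +-assoc (Φ x) _ k ⟩
    Φ x + (k * N y + k)   ≡⟨ cong (Φ x +_) (+-comm _ k) ⟩
    Φ x + (k + k * N y)   ≡⟨ +-assoc (Φ x) k _ ⟨
    Φ x + k + k * N y     ≤⟨ +-monoˡ-≤ _ Φx+k≤Φz ⟩
    _ + k * N y           ≤⟨ star-potential z→*y ⟩
    Φ y + k * _           ≡⟨ cong (λ t → Φ y + k * t) Nz≡ ⟩
    Φ y + k * suc (N x)   ≡⟨ cong (Φ y +_) (trans (*-suc k (N x)) (+-comm k _)) ⟩
    Φ y + (k * N x + k)   ≡⟨ +-assoc (Φ y) _ k ⟨
    Φ y + k * N x + k     ∎)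
    where open ≤-Reasoning

step-potential : ∀ {n} (G : Graph n) {p} {q : Maybe ℕ} {c c'} → Step G p q c c' →
                 countTrue c' ≡ suc (countTrue c) × blueDegreeSum G c + 2 * p ≤ blueDegreeSum G c'
step-potential {zero}  G (() , _)
step-potential {suc n} G {p} {c = c} {c'} (w , (white , p≤X , _) , update) =
  countTrue-recolour , (begin
    blueDegreeSum G c + 2 * p               ≤⟨ +-monoʳ-≤ (blueDegreeSum G c) (*-monoʳ-≤ 2 p≤X) ⟩
    blueDegreeSum G c + 2 * blueNbrs G c w  ≡⟨ blueDegreeSum-recolour ⟨
    blueDegreeSum G c'                      ∎)
  where
  open ≤-Reasoning
  open Recolouring G {c} {c'} {w} white (trans (update w) (recolour-at c w true))
                                     (λ u → trans (update (punchIn w u)) (recolour-off c w true u))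

IsWalk : ∀ {n} → Graph n → (ℕ → Fin n) → Set
IsWalk G g = ∀ k → Adj G (g k) (g (suc k))

NonBacktracking : ∀ {n} → (ℕ → Fin n) → Set
NonBacktracking g = ∀ k → g (suc (suc k)) ≢ g k

InjectiveBelow : ∀ {n} → (ℕ → Fin n) → ℕ → Set
InjectiveBelow g j = ∀ {i i'} → i < i' → i' < j → g i ≢ g i'

walk-path : ∀ {n} (G : Graph n) {g} → IsWalk G g → ∀ r → PathList G (g 0) (applyUpTo g (suc r)) (g r)
walk-path G walk zero    = single
walk-path G walk (suc r) = cons (walk 0) (walk-path G (walk ∘ suc) r)

closed-walk⇒cycle : ∀ {n} (G : Graph n) {g} → IsWalk G g → NonBacktracking g →
                    ∀ ℓ → g (suc ℓ) ≡ g 0 → InjectiveBelow g (suc ℓ) → HasCycle G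
closed-walk⇒cycle G {g} walk nb zero closed _ =
  contradiction (trans (sym (subst (Adj G (g 0)) closed (walk 0))) (irrefl G (g 0))) λ ()
closed-walk⇒cycle G walk nb (suc zero) closed _ = contradiction closed (nb 0)
closed-walk⇒cycle G {g} walk nb (suc (suc r)) closed injective =
  g 0 , g (2 + r) , g 1 , g 2 , applyUpTo (g ∘ (3 +_)) r ,
  walk-path G walk (2 + r) , applyUpTo⁺₁ g (3 + r) injective , subst (Adj G (g (2 + r))) closed (walk (2 + r))

Repeats : ∀ {n} → (ℕ → Fin n) → ℕ → Set
Repeats g j = ∃ λ i → i < j × g i ≡ g j

first-repeat : ∀ {n} (g : ℕ → Fin n) j → Repeats g j → ∃ λ j → Repeats g j × InjectiveBelow g j
first-repeat g = <-rec P go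
  where
  P : ℕ → Set
  P j = Repeats g j → ∃ λ j → Repeats g j × InjectiveBelow g j
  go : ∀ j → (∀ {j'} → j' < j → P j') → P j
  go j earlier repeat with anyUpTo? (λ i' → anyUpTo? (λ i → g i ≟ g i') i') j
  ... | yes (i' , i'<j , repeat') = earlier i'<j repeat'
  ... | no none = j , repeat , λ i<i' i'<j gᵢ≡gᵢ' → none (_ , i'<j , _ , i<i' , gᵢ≡gᵢ')

nonBacktracking-walk⇒cycle : ∀ {n} (G : Graph n) {g} → IsWalk G g → NonBacktracking g → HasCycle G
nonBacktracking-walk⇒cycle {n} G {g} walk nb with pigeonhole (n<1+n n) (g ∘ toℕ)
... | i , j , i<j , gᵢ≡gⱼ with first-repeat g (toℕ j) (toℕ i , i<j , gᵢ≡gⱼ)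
... | b , (a , a<b , gₐ≡g_b) , injective with m≤n⇒∃[o]m+o≡n a<b
... | ℓ , refl = closed-walk⇒cycle G (walk ∘ (_+ a)) (nb ∘ (_+ a)) ℓ closed injective-from-a
  where
  1+ℓ+a≡1+a+ℓ : suc ℓ + a ≡ suc a + ℓ
  1+ℓ+a≡1+a+ℓ = cong suc (+-comm ℓ a)
  closed : g (suc ℓ + a) ≡ g a
  closed = trans (cong g 1+ℓ+a≡1+a+ℓ) (sym gₐ≡g_b)
  injective-from-a : InjectiveBelow (λ i → g (i + a)) (suc ℓ)
  injective-from-a i<i' i'<1+ℓ = injective (+-monoˡ-< a i<i') (≤-trans (+-monoˡ-< a i'<1+ℓ) (≤-reflexive 1+ℓ+a≡1+a+ℓ))

another-blue-neighbour : ∀ {n} (G : Graph n) c v (u : Fin n) → 2 ≤ blueNbrs G c v →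
                         ∃ λ w → w ≢ u × Adj G v w × c w ≡ true
another-blue-neighbour {suc n} G c v u two =
  let x , e = countTrue-exists (removeAt blueNbr u) one
  in punchIn u x , punchInᵢ≢i u x , ∧-conicalˡ _ _ e , ∧-conicalʳ _ _ e
  where
  blueNbr : Fin (suc n) → Bool
  blueNbr x = adj G v x ∧ c x
  one : 1 ≤ countTrue (removeAt blueNbr u)
  one = +-cancelˡ-≤ 1 1 _ (≤-trans (subst (2 ≤_) (countTrue-removeAt blueNbr u) two)
                                    (+-monoˡ-≤ _ (indicator≤1 (blueNbr u))))

min-blue-degree-two⇒cycle : ∀ {n} (G : Graph n) c {v₀} → c v₀ ≡ true →
                            (∀ v → c v ≡ true → 2 ≤ blueNbrs G c v) → HasCycle G
min-blue-degree-two⇒cycle {n} G c {v₀} blue₀ two =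
  nonBacktracking-walk⇒cycle G (λ k → proj₁ (proj₂ (proj₂ (successor k))))
                               (λ k → proj₁ (proj₂ (successor (suc k))))
  where
  trail : ℕ → Fin n × ∃ λ v → c v ≡ true
  successor : ∀ k → let prev , cur , _ = trail k in ∃ λ w → w ≢ prev × Adj G cur w × c w ≡ true
  trail zero    = v₀ , v₀ , blue₀
  trail (suc k) = let _ , cur , _ = trail k ; w , _ , _ , blue = successor k in cur , w , blue
  successor k = let prev , cur , blue = trail k in another-blue-neighbour G c cur prev (two cur blue)

acyclic⇒blue-leaf : ∀ {n} (G : Graph n) c {v₀} → Acyclic G → c v₀ ≡ true →
                    ∃ λ i → c i ≡ true × blueNbrs G c i ≤ 1
acyclic⇒blue-leaf G c acyclic blue₀ with any? (λ i → (c i ≟ᵇ true) ×-dec (blueNbrs G c i ≤? 1))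
... | yes leaf   = leaf
... | no no-leaf =
  contradiction (min-blue-degree-two⇒cycle G c blue₀ λ v blue → ≰⇒> λ ≤1 → no-leaf (v , blue , ≤1)) acyclic

pred[n]+m≤n : ∀ {m n} → m ≤ 1 → m ≤ n → pred n + m ≤ n
pred[n]+m≤n {n = zero}  _   m≤0 = m≤0
pred[n]+m≤n {n = suc n} m≤1 _   = ≤-trans (+-monoʳ-≤ n m≤1) (≤-reflexive (+-comm n 1))

blueDegreeSum-acyclic : ∀ {n} (G : Graph n) → Acyclic G → ∀ k c → countTrue c ≡ k → blueDegreeSum G c ≤ 2 * pred k
blueDegreeSum-acyclic G acyclic zero c none = ≤-reflexive (blueDegreeSum-white G c (countTrue≡0 none))
blueDegreeSum-acyclic {zero} G acyclic (suc k) c ()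
blueDegreeSum-acyclic {suc n} G acyclic (suc k) c count≡
  with acyclic⇒blue-leaf G c acyclic (proj₂ (countTrue-exists c (subst (1 ≤_) (sym count≡) (s≤s z≤n))))
... | i , blueᵢ , leaf = begin
  blueDegreeSum G c             ≡⟨ blueDegreeSum-recolour ⟩
  blueDegreeSum G c⁻ + 2 * X    ≤⟨ +-monoˡ-≤ (2 * X) (blueDegreeSum-acyclic G acyclic k c⁻ count⁻) ⟩
  2 * pred k + 2 * X            ≡⟨ *-distribˡ-+ 2 (pred k) X ⟨
  2 * (pred k + X)              ≤⟨ *-monoʳ-≤ 2 (pred[n]+m≤n X≤1 X≤k) ⟩
  2 * k                         ∎
  where
  open ≤-Reasoning
  c⁻ = recolour c i false
  open Recolouring G {c⁻} {c} {i} (recolour-at c i false) blueᵢ (λ u → sym (recolour-off c i false u))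
  X = blueNbrs G c⁻ i
  count⁻ : countTrue c⁻ ≡ k
  count⁻ = suc-injective (trans (sym countTrue-recolour) count≡)
  X≤1 : X ≤ 1
  X≤1 = subst (_≤ 1) blueNbrs-recolour-self leaf
  X≤k : X ≤ k
  X≤k = subst (X ≤_) count⁻ (blueNbrs≤countTrue G c⁻ i)

spreadingSet-acyclic : ∀ {m} (G : Graph (suc m)) → Acyclic G → ∀ {p q S} → IsSpreadingSet G p q S →
                       p * suc m ≤ m + p * countTrue S
spreadingSet-acyclic {m} G acyclic {p} {S = S} (c , S→*c , all-blue) = *-cancelˡ-≤ 2 (begin
  2 * (p * suc m)                             ≡⟨ *-assoc 2 p (suc m) ⟨
  2 * p * suc m                               ≡⟨ cong (2 * p *_) count≡ ⟨
  2 * p * countTrue c                         ≤⟨ m≤n+m _ (blueDegreeSum G S) ⟩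
  blueDegreeSum G S + 2 * p * countTrue c     ≤⟨ star-potential countTrue (blueDegreeSum G) (2 * p) (step-potential G) S→*c ⟩
  blueDegreeSum G c + 2 * p * countTrue S     ≤⟨ +-monoˡ-≤ _ (blueDegreeSum-acyclic G acyclic (suc m) c count≡) ⟩
  2 * m + 2 * p * countTrue S                 ≡⟨ cong (2 * m +_) (*-assoc 2 p (countTrue S)) ⟩
  2 * m + 2 * (p * countTrue S)               ≡⟨ *-distribˡ-+ 2 m (p * countTrue S) ⟨
  2 * (m + p * countTrue S)                   ∎)
  where
  open ≤-Reasoning
  count≡ : countTrue c ≡ suc m
  count≡ = countTrue-all all-blue

m≤n*o⇒⌈m/o⌉≤n : ∀ {m n o} .{{_ : NonZero o}} → m ≤ n * o → ⌈ m / o ⌉ ≤ n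
m≤n*o⇒⌈m/o⌉≤n {m} {n} {suc o} m≤n*o =
  s≤s⁻¹ (m<n*o⇒m/o<n (subst (m + o <_) (+-comm (n * suc o) (suc o)) (+-mono-≤-< m≤n*o (n<1+n o))))

theorem4p6 : (n : ℕ) → 1 ≤ n → (T : Graph n) → IsTree T →
    (p : ℕ) → .{{_ : NonZero p}} → 2 ≤ p → (q : Maybe ℕ) → (S : Fin n → Bool) → IsSpreadingSet T p q S →
    ⌈ ((p ∸ 1) * n + 1) / p ⌉ ≤ countTrue S
theorem4p6 (suc m) _ T (_ , acyclic) (suc p) _ q S spreads =
  m≤n*o⇒⌈m/o⌉≤n (rearrange (spreadingSet-acyclic T acyclic spreads))
  where
  s = countTrue S
  rearrange : suc p * suc m ≤ m + suc p * s → p * suc m + 1 ≤ s * suc p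
  rearrange bound = +-cancelˡ-≤ m _ _ (begin
    m + (p * suc m + 1) ≡⟨ lhs≡ m p ⟩
    suc p * suc m       ≤⟨ bound ⟩
    m + suc p * s       ≡⟨ cong (m +_) (*-comm (suc p) s) ⟩
    m + s * suc p       ∎)
    where
    open ≤-Reasoning
    lhs≡ : ∀ m p → m + (p * suc m + 1) ≡ suc p * suc m
    lhs≡ = solve-∀
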